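{- Let $X$ be a nonempty set of choice functions for $L$ all of which are associative. Then $|$ is associative with respect to $\models_X$: for all $\varphi,\psi,\sigma\in Sen(L_s)$, $\varphi|(\psi|\sigma)\sim_X(\varphi|\psi)|\sigma$.
   Context: Let $L$ be the propositional language with atoms $p_0,p_1,\ldots$ and connectives $\neg,\wedge$ (others defined as usual); $L_s$ adds a primitive binary connective $|$. A truth assignment $M$ is a classical valuation of $Sen(L)$. A choice function for $L$ is a map $f$ assigning to each set $\{\alpha,\beta\}$ of $L$-sentences (possibly $\alpha=\beta$) an element $f(\alpha,\beta)\in\{\alpha,\beta\}$; it is associative if $f(f(\alpha,\beta),\gamma)=f(\alpha,f(\beta,\gamma))$ for all $\alpha,\beta,\gamma\in Sen(L)$. Each $f$ induces $\overline f:Sen(L_s)\to Sen(L)$: $\overline f(\alpha)=\alpha$ for classical $\alpha$, $\overline f$ commutes with $\neg,\wedge$, and $\overline f(\varphi|\psi)=f(\overline f(\varphi),\overline f(\psi))$. $\langle M,f\rangle\models_s\varphi$ iff $M\models\overline f(\varphi)$. For a set $X$ of choice functions, $\varphi\sim_X\psi$ means: for every $M$ and every $f\in X$, $\langle M,f\rangle\models_s\varphi\iff\langle M,f\rangle\models_s\psi$. -}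

module Defs where

open import Data.Nat using (ℕ)
open import Data.Bool using (Bool; true; false; not; _∧_)
open import Data.Sum using (_⊎_)
open import Data.Product using (Σ; ∃; _×_)
open import Relation.Binary.PropositionalEquality using (_≡_)
open import Level using (Level; suc; _⊔_; 0ℓ)

data Sen : Set where
  atom : ℕ → Sen
  ¬ₗ_  : Sen → Sen
  _∧ₗ_ : Sen → Sen → Sen

data SenS : Set where
  atom : ℕ → SenS
  ¬ₛ_  : SenS → SenS
  _∧ₛ_ : SenS → SenS → SenS
  _∣ₛ_ : SenS → SenS → SenS

record TruthAssignment : Set where
  field
    val   : Sen → Bool
    val-¬ : ∀ α → val (¬ₗ α) ≡ not (val α)
    val-∧ : ∀ α β → val (α ∧ₗ β) ≡ (val α ∧ val β)
open TruthAssignment public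

-- A choice function: picks an element of each set {α, β}.  Modelled as a
-- binary operation that depends only on the set {α,β} (symmetry) and
-- returns one of its arguments.
record ChoiceFunction : Set where
  field
    choose     : Sen → Sen → Sen
    choose-sym : ∀ α β → choose α β ≡ choose β α
    choose-sel : ∀ α β → (choose α β ≡ α) ⊎ (choose α β ≡ β)
open ChoiceFunction public

Associative : ChoiceFunction → Set
Associative f = ∀ α β γ →
  choose f (choose f α β) γ ≡ choose f α (choose f β γ)

-- the induced translation f̄ : Sen(L_s) → Sen(L)
-- (classical sentences are exactly those without |, on which f̄ is the identity)
bar : ChoiceFunction → SenS → Sen
bar f (atom n)  = atom n
bar f (¬ₛ φ)    = ¬ₗ bar f φ
bar f (φ ∧ₛ ψ)  = bar f φ ∧ₗ bar f ψ
bar f (φ ∣ₛ ψ)  = choose f (bar f φ) (bar f ψ)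

_⊨ₛ_ : TruthAssignment × ChoiceFunction → SenS → Set
(M Data.Product., f) ⊨ₛ φ = val M (bar f φ) ≡ true

ChoiceSet : Set₁
ChoiceSet = ChoiceFunction → Set

_∼[_]_ : SenS → ChoiceSet → SenS → Set
φ ∼[ X ] ψ = ∀ (M : TruthAssignment) (f : ChoiceFunction) → X f →
  (((M Data.Product., f) ⊨ₛ φ → (M Data.Product., f) ⊨ₛ ψ) ×
   ((M Data.Product., f) ⊨ₛ ψ → (M Data.Product., f) ⊨ₛ φ))

{-# OPTIONS --safe #-}
module Submission where

open import Defs
open import Data.Product using (Σ; _,_)
open import Relation.Binary.PropositionalEquality using (_≡_; sym; subst)

bar-∣ₛ-assoc : ∀ f → Associative f → ∀ φ ψ σ →
  bar f (φ ∣ₛ (ψ ∣ₛ σ)) ≡ bar f ((φ ∣ₛ ψ) ∣ₛ σ)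
bar-∣ₛ-assoc f assoc φ ψ σ = sym (assoc (bar f φ) (bar f ψ) (bar f σ))

bar-≡⇒∼ : ∀ (X : ChoiceSet) {φ ψ} →
  (∀ f → X f → bar f φ ≡ bar f ψ) → φ ∼[ X ] ψ
bar-≡⇒∼ X eq M f xf =
  subst (λ s → val M s ≡ _) (eq f xf) ,
  subst (λ s → val M s ≡ _) (sym (eq f xf))

theorem2p19 : (X : ChoiceSet) → Σ ChoiceFunction X → (∀ f → X f → Associative f) →
    ∀ φ ψ σ → (φ ∣ₛ (ψ ∣ₛ σ)) ∼[ X ] ((φ ∣ₛ ψ) ∣ₛ σ)
theorem2p19 X _ assoc φ ψ σ =
  bar-≡⇒∼ X {φ ∣ₛ (ψ ∣ₛ σ)} {(φ ∣ₛ ψ) ∣ₛ σ} (λ f xf → bar-∣ₛ-assoc f (assoc f xf) φ ψ σ)
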